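{- Let $\alpha_1, \alpha_2, \alpha_3$ be positive integers. For all $n \ge 0$, $$|P(n,2)| \le [x^{n(\alpha_1+\alpha_2+\alpha_3)}] \left( \frac{1}{1 - x^{\alpha_1} - x^{\alpha_2} - x^{\alpha_3} + x^{\alpha_1+\alpha_3} + 2x^{\alpha_1 + 2\alpha_2 + \alpha_3}} \right),$$ where $[x^m]F(x)$ denotes the coefficient of $x^m$ in the formal power series $F(x)$.
   Context: A system of $2$ stacks in series consists of an input queue, stack 1, stack 2, and an output queue; the legal moves are: move the front element of the input queue onto stack 1, pop the top of stack 1 and push it onto stack 2, and pop the top of stack 2 and enqueue it on the output queue. A permutation $\pi \in S_n$ is generated by 2 stacks if, starting with input queue (front to back) $1,\ldots,n$ and all else empty, some finite sequence of legal moves ends with all elements in the output queue in order $\pi(1),\ldots,\pi(n)$. $P(n,2) \subseteq S_n$ is the set of permutations generated by 2 stacks. -}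

module Defs where

open import Data.Nat using (ℕ; zero; suc; _≟_)
open import Data.Integer using (ℤ; 0ℤ; 1ℤ) renaming (_+_ to _+ℤ_; _*_ to _*ℤ_; -_ to -ℤ_)
open import Data.List using (List; []; _∷_; _++_; [_]; map; upTo; foldr)
open import Data.Integer using () renaming (+_ to ℤ+)
open import Relation.Nullary using (yes; no)
open import Relation.Binary.Construct.Closure.ReflexiveTransitive using (Star)
open import Relation.Binary.PropositionalEquality using (_≡_)

-- A configuration: input queue (front first), stack 1 (top first),
-- stack 2 (top first), output queue (front first).
record Config : Set where
  constructor cfg
  field
    input  : List ℕ
    stack1 : List ℕ
    stack2 : List ℕ
    output : List ℕ

data Move : Config → Config → Set where
  in→s1  : ∀ {x i s t o} → Move (cfg (x ∷ i) s t o) (cfg i (x ∷ s) t o)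
  s1→s2  : ∀ {x i s t o} → Move (cfg i (x ∷ s) t o) (cfg i s (x ∷ t) o)
  s2→out : ∀ {x i s t o} → Move (cfg i s (x ∷ t) o) (cfg i s t (o ++ [ x ]))

inputQueue : ℕ → List ℕ
inputQueue n = map suc (upTo n)

GeneratedBy2Stacks : (n : ℕ) → List ℕ → Set
GeneratedBy2Stacks n π = Star Move (cfg (inputQueue n) [] [] []) (cfg [] [] [] π)

Series : Set
Series = ℕ → ℤ

mono : ℕ → Series
mono k j with j ≟ k
... | yes _ = 1ℤ
... | no  _ = 0ℤ

_⊕_ : Series → Series → Series
(f ⊕ g) j = f j +ℤ g j

_⊖_ : Series → Series → Series
(f ⊖ g) j = f j +ℤ (-ℤ (g j))

scale : ℤ → Series → Series
scale c f j = c *ℤ f j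

_⊛_ : Series → Series → Series
(f ⊛ g) m = foldr _+ℤ_ 0ℤ (map (λ j → f j *ℤ g (m Data.Nat.∸ j)) (upTo (suc m)))

one : Series
one = mono 0

denom : ℕ → ℕ → ℕ → Series
denom a₁ a₂ a₃ =
  ((((one ⊖ mono a₁) ⊖ mono a₂) ⊖ mono a₃) ⊕ mono (a₁ Data.Nat.+ a₃))
    ⊕ scale (ℤ+ 2) (mono (a₁ Data.Nat.+ 2 Data.Nat.* a₂ Data.Nat.+ a₃))

IsInverseOf : Series → Series → Set
IsInverseOf F D = ∀ m → (D ⊛ F) m ≡ one m

-- A generating sequence of moves is a word over A (input to stack 1),
-- B (stack 1 to stack 2) and C (stack 2 to output). The rewrites
-- AC → CA, ABBC → BCAB and ABCB → BABC do not change the result and move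
-- an A to the right past a B or C, so every permutation in P(n,2) is
-- produced by a word avoiding the factors AC, ABBC and ABCB, and distinct
-- permutations need distinct words. Weighting A, B, C by α₁, α₂, α₃, each
-- such word has weight n(α₁+α₂+α₃), since every item makes each move once.
-- The avoiding words are recognised by a five-state automaton whose
-- transfer equations are solved by F times polynomials; induction on the
-- weight along these equations bounds the number of accepted words of
-- weight m by the coefficient of x^m in F.
module Submission where

open import Defs
open import Data.Empty using (⊥)
open import Data.Integer using (ℤ; 0ℤ; 1ℤ; +_; +≤+; -_)
  renaming (_+_ to _⊹_; _*_ to _⋆_; _-_ to _⊟_; _≤_ to _≤ℤ_)
import Data.Integer.Properties as ℤ
open import Algebra.Properties.CommutativeSemigroup ℤ.+-commutativeSemigroup using (interchange)
import Data.Integer.Tactic.RingSolver as ℤ-Ring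
open import Data.List using (List; []; _∷_; _++_; [_]; length; map; foldr; upTo)
import Data.List.Properties as List
open import Data.List.Relation.Binary.Pointwise using (Pointwise; []; _∷_; Pointwise-length)
open import Data.List.Relation.Unary.All as All using (All; []; _∷_)
open import Data.List.Relation.Unary.AllPairs using ([]; _∷_)
open import Data.List.Relation.Unary.Unique.Propositional using (Unique)
open import Data.Maybe using (Maybe; just; nothing; _>>=_)
open import Data.Maybe.Properties using (just-injective)
open import Data.Nat using (ℕ; zero; suc; _+_; _*_; _∸_; _≤_; _<_; z≤n; s≤s; _≤?_; _≟_)
open import Data.Nat.Induction using (<-rec; <-wellFounded)
open import Data.Nat.ListAction using (sum)
import Data.Nat.Properties as ℕ
import Data.Nat.Tactic.RingSolver as ℕ-Ring
open import Data.Product using (∃; _×_; _,_)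
import Data.Product as Prod
open import Data.Sum using (_⊎_; inj₁; inj₂)
import Data.Sum as Sum
open import Data.Unit using (⊤)
open import Function using (_∘_; const)
import Induction.WellFounded as WF
import Relation.Binary.Construct.On as On
open import Relation.Binary.Construct.Closure.ReflexiveTransitive using (Star; ε; _◅_)
open import Relation.Binary.Definitions using (DecidableEquality)
open import Relation.Binary.PropositionalEquality
  using (_≡_; _≢_; _≗_; refl; sym; trans; cong; cong₂; subst; subst₂; module ≡-Reasoning)
open import Relation.Nullary using (yes; no; ¬_; contradiction)

data Letter : Set where
  A B C : Letter

Word : Set
Word = List Letter

_≟ᴸ_ : DecidableEquality Letter
A ≟ᴸ A = yes refl
A ≟ᴸ B = no λ ()
A ≟ᴸ C = no λ ()
B ≟ᴸ A = no λ ()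
B ≟ᴸ B = yes refl
B ≟ᴸ C = no λ ()
C ≟ᴸ A = no λ ()
C ≟ᴸ B = no λ ()
C ≟ᴸ C = yes refl

module _ {Q : Set} (δ : Q → Letter → Maybe Q) where

  Accepts : Maybe Q → Word → Set
  Accepts nothing  w       = ⊥
  Accepts (just q) []      = ⊤
  Accepts (just q) (x ∷ w) = Accepts (δ q x) w

weight : (Letter → ℕ) → Word → ℕ
weight wt w = sum (map wt w)

step : Letter → Config → Maybe Config
step A (cfg (x ∷ i) s t o) = just (cfg i (x ∷ s) t o)
step B (cfg i (x ∷ s) t o) = just (cfg i s (x ∷ t) o)
step C (cfg i s (x ∷ t) o) = just (cfg i s t (o ++ [ x ]))
step _ _                   = nothing

run : Word → Config → Maybe Config
run []      c = just c
run (x ∷ w) c = step x c >>= run w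

word-of-moves : ∀ {c c′} → Star Move c c′ → ∃ λ w → run w c ≡ just c′
word-of-moves ε = [] , refl
word-of-moves (in→s1  ◅ r) with word-of-moves r
... | w , run≡ = A ∷ w , run≡
word-of-moves (s1→s2  ◅ r) with word-of-moves r
... | w , run≡ = B ∷ w , run≡
word-of-moves (s2→out ◅ r) with word-of-moves r
... | w , run≡ = C ∷ w , run≡

infix 4 _↝_
infixr 5 _∷_

data _↝_ : Word → Word → Set where
  AC↝CA     : ∀ {w} → A ∷ C ∷ w ↝ C ∷ A ∷ w
  ABBC↝BCAB : ∀ {w} → A ∷ B ∷ B ∷ C ∷ w ↝ B ∷ C ∷ A ∷ B ∷ w
  ABCB↝BABC : ∀ {w} → A ∷ B ∷ C ∷ B ∷ w ↝ B ∷ A ∷ B ∷ C ∷ w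
  _∷_       : ∀ x {w w′} → w ↝ w′ → x ∷ w ↝ x ∷ w′

↝-run : ∀ {w w′} → w ↝ w′ → run w ≗ run w′
↝-run AC↝CA     (cfg []      s []      o) = refl
↝-run AC↝CA     (cfg []      s (_ ∷ _) o) = refl
↝-run AC↝CA     (cfg (_ ∷ _) s []      o) = refl
↝-run AC↝CA     (cfg (_ ∷ _) s (_ ∷ _) o) = refl
↝-run ABBC↝BCAB (cfg []      []      t o) = refl
↝-run ABBC↝BCAB (cfg []      (_ ∷ _) t o) = refl
↝-run ABBC↝BCAB (cfg (_ ∷ _) []      t o) = refl
↝-run ABBC↝BCAB (cfg (_ ∷ _) (_ ∷ _) t o) = refl
↝-run ABCB↝BABC (cfg []      []      t o) = refl
↝-run ABCB↝BABC (cfg []      (_ ∷ _) t o) = refl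
↝-run ABCB↝BABC (cfg (_ ∷ _) []      t o) = refl
↝-run ABCB↝BABC (cfg (_ ∷ _) (_ ∷ _) t o) = refl
↝-run (x ∷ r) c with step x c
... | nothing = refl
... | just c′ = ↝-run r c′

countBC : Word → ℕ
countBC []      = 0
countBC (A ∷ w) = countBC w
countBC (B ∷ w) = suc (countBC w)
countBC (C ∷ w) = suc (countBC w)

inversions : Word → ℕ
inversions []      = 0
inversions (A ∷ w) = countBC w + inversions w
inversions (B ∷ w) = inversions w
inversions (C ∷ w) = inversions w

↝-countBC : ∀ {w w′} → w ↝ w′ → countBC w ≡ countBC w′
↝-countBC AC↝CA     = refl
↝-countBC ABBC↝BCAB = refl
↝-countBC ABCB↝BABC = refl
↝-countBC (A ∷ r)   = ↝-countBC r
↝-countBC (B ∷ r)   = cong suc (↝-countBC r)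
↝-countBC (C ∷ r)   = cong suc (↝-countBC r)

↝-inversions : ∀ {w w′} → w ↝ w′ → inversions w′ < inversions w
↝-inversions AC↝CA     = ℕ.≤-refl
↝-inversions ABBC↝BCAB = ℕ.n≤1+n _
↝-inversions ABCB↝BABC = ℕ.≤-refl
↝-inversions (A ∷ r) rewrite ↝-countBC r = ℕ.+-monoʳ-< _ (↝-inversions r)
↝-inversions (B ∷ r)   = ↝-inversions r
↝-inversions (C ∷ r)   = ↝-inversions r

-- The automaton for the words avoiding the factors AC, ABBC and ABCB:
-- a state records the longest suffix read so far that is a proper
-- prefix of one of them.
data State : Set where
  q₀ qA qAB qABB qABC : State

pending : State → Word
pending q₀   = []
pending qA   = A ∷ []
pending qAB  = A ∷ B ∷ []
pending qABB = A ∷ B ∷ B ∷ []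
pending qABC = A ∷ B ∷ C ∷ []

δ : State → Letter → Maybe State
δ q₀   A = just qA
δ q₀   B = just q₀
δ q₀   C = just q₀
δ qA   A = just qA
δ qA   B = just qAB
δ qA   C = nothing
δ qAB  A = just qA
δ qAB  B = just qABB
δ qAB  C = just qABC
δ qABB A = just qA
δ qABB B = just q₀
δ qABB C = nothing
δ qABC A = just qA
δ qABC B = nothing
δ qABC C = just q₀

prefix-↝ : ∀ p {w w′} → w ↝ w′ → p ++ w ↝ p ++ w′
prefix-↝ []      r = r
prefix-↝ (x ∷ p) r = x ∷ prefix-↝ p r

AcceptsOrRewrites : State → Word → Set
AcceptsOrRewrites q w = Accepts δ (just q) w ⊎ ∃ λ w′ → pending q ++ w ↝ w′

accepts-or-rewrites : ∀ q w → AcceptsOrRewrites q w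

after : ∀ p q w → Accepts δ (just q) w ⊎ ∃ λ w′ → p ++ pending q ++ w ↝ w′
after p q w = Sum.map₂ (Prod.map (p ++_) (prefix-↝ p)) (accepts-or-rewrites q w)

accepts-or-rewrites q    []      = inj₁ _
accepts-or-rewrites q₀   (A ∷ w) = accepts-or-rewrites qA w
accepts-or-rewrites q₀   (B ∷ w) = after (B ∷ []) q₀ w
accepts-or-rewrites q₀   (C ∷ w) = after (C ∷ []) q₀ w
accepts-or-rewrites qA   (A ∷ w) = after (A ∷ []) qA w
accepts-or-rewrites qA   (B ∷ w) = accepts-or-rewrites qAB w
accepts-or-rewrites qA   (C ∷ w) = inj₂ (_ , AC↝CA)
accepts-or-rewrites qAB  (A ∷ w) = after (A ∷ B ∷ []) qA w
accepts-or-rewrites qAB  (B ∷ w) = accepts-or-rewrites qABB w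
accepts-or-rewrites qAB  (C ∷ w) = accepts-or-rewrites qABC w
accepts-or-rewrites qABB (A ∷ w) = after (A ∷ B ∷ B ∷ []) qA w
accepts-or-rewrites qABB (B ∷ w) = after (A ∷ B ∷ B ∷ B ∷ []) q₀ w
accepts-or-rewrites qABB (C ∷ w) = inj₂ (_ , ABBC↝BCAB)
accepts-or-rewrites qABC (A ∷ w) = after (A ∷ B ∷ C ∷ []) qA w
accepts-or-rewrites qABC (B ∷ w) = inj₂ (_ , ABCB↝BABC)
accepts-or-rewrites qABC (C ∷ w) = after (A ∷ B ∷ C ∷ C ∷ []) q₀ w

HasNormalForm : Word → Set
HasNormalForm w = ∃ λ v → Accepts δ (just q₀) v × run w ≗ run v

normalise : ∀ w → HasNormalForm w
normalise = WF.All.wfRec (On.wellFounded inversions <-wellFounded) _ HasNormalForm rewrite-step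
  where
  rewrite-step : ∀ w → (∀ {w′} → inversions w′ < inversions w → HasNormalForm w′) → HasNormalForm w
  rewrite-step w ih with accepts-or-rewrites q₀ w
  ... | inj₁ acc      = w , acc , λ _ → refl
  ... | inj₂ (w′ , r) with ih {w′} (↝-inversions r)
  ... | v , acc , w′≗v = v , acc , λ c → trans (↝-run r c) (w′≗v c)

shift : ℕ → Series → Series
shift zero    f m       = f m
shift (suc k) f zero    = 0ℤ
shift (suc k) f (suc m) = shift k f m

shift-≤ : ∀ {k m} f → k ≤ m → shift k f m ≡ f (m ∸ k)
shift-≤ {zero}          f _         = refl
shift-≤ {suc k} {suc m} f (s≤s k≤m) = shift-≤ f k≤m

shift-≰ : ∀ {k m} f → ¬ k ≤ m → shift k f m ≡ 0ℤ
shift-≰ {zero}          f k≰m = contradiction z≤n k≰m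
shift-≰ {suc k} {zero}  f k≰m = refl
shift-≰ {suc k} {suc m} f k≰m = shift-≰ f (k≰m ∘ s≤s)

shift-shift : ∀ k j f → shift k (shift j f) ≗ shift (k + j) f
shift-shift zero    j f m       = refl
shift-shift (suc k) j f zero    = refl
shift-shift (suc k) j f (suc m) = shift-shift k j f m

shift-⊖ : ∀ k f g → shift k (f ⊖ g) ≗ shift k f ⊖ shift k g
shift-⊖ zero    f g m       = refl
shift-⊖ (suc k) f g zero    = refl
shift-⊖ (suc k) f g (suc m) = shift-⊖ k f g m

shift-scale : ∀ k z f → shift k (scale z f) ≗ scale z (shift k f)
shift-scale zero    z f m       = refl
shift-scale (suc k) z f zero    = sym (ℤ.*-zeroʳ z)
shift-scale (suc k) z f (suc m) = shift-scale k z f m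

shift-0 : ∀ k → shift k (const 0ℤ) ≗ const 0ℤ
shift-0 zero    m       = refl
shift-0 (suc k) zero    = refl
shift-0 (suc k) (suc m) = shift-0 k m

∑ : List ℕ → (ℕ → ℤ) → ℤ
∑ js φ = foldr _⊹_ 0ℤ (map φ js)

∑-cong : ∀ js {φ ψ} → φ ≗ ψ → ∑ js φ ≡ ∑ js ψ
∑-cong []       φ≗ψ = refl
∑-cong (j ∷ js) φ≗ψ = cong₂ _⊹_ (φ≗ψ j) (∑-cong js φ≗ψ)

∑-+ : ∀ js φ ψ → ∑ js (λ j → φ j ⊹ ψ j) ≡ ∑ js φ ⊹ ∑ js ψ
∑-+ []       φ ψ = refl
∑-+ (j ∷ js) φ ψ = trans (cong (φ j ⊹ ψ j ⊹_) (∑-+ js φ ψ)) (interchange (φ j) (ψ j) _ _)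

∑-neg : ∀ js φ → ∑ js (λ j → - φ j) ≡ - ∑ js φ
∑-neg []       φ = refl
∑-neg (j ∷ js) φ = trans (cong (- φ j ⊹_) (∑-neg js φ)) (sym (ℤ.neg-distrib-+ (φ j) _))

∑-scale : ∀ js z φ → ∑ js (λ j → z ⋆ φ j) ≡ z ⋆ ∑ js φ
∑-scale []       z φ = sym (ℤ.*-zeroʳ z)
∑-scale (j ∷ js) z φ = trans (cong (z ⋆ φ j ⊹_) (∑-scale js z φ)) (sym (ℤ.*-distribˡ-+ z (φ j) _))

∑-++ : ∀ is js φ → ∑ (is ++ js) φ ≡ ∑ is φ ⊹ ∑ js φ
∑-++ []       js φ = sym (ℤ.+-identityˡ _)
∑-++ (i ∷ is) js φ = trans (cong (φ i ⊹_) (∑-++ is js φ)) (sym (ℤ.+-assoc (φ i) _ _))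

∑-upTo-suc : ∀ n φ → ∑ (upTo (suc n)) φ ≡ ∑ (upTo n) φ ⊹ φ n
∑-upTo-suc n φ = begin
  ∑ (upTo (suc n)) φ       ≡⟨ cong (λ js → ∑ js φ) (List.upTo-∷ʳ n) ⟨
  ∑ (upTo n ++ [ n ]) φ    ≡⟨ ∑-++ (upTo n) [ n ] φ ⟩
  ∑ (upTo n) φ ⊹ (φ n ⊹ 0ℤ) ≡⟨ cong (∑ (upTo n) φ ⊹_) (ℤ.+-identityʳ (φ n)) ⟩
  ∑ (upTo n) φ ⊹ φ n       ∎
  where open ≡-Reasoning

mono-diag : ∀ k → mono k k ≡ 1ℤ
mono-diag k with k ≟ k
... | yes _   = refl
... | no k≢k = contradiction refl k≢k

mono-off : ∀ {k j} → j ≢ k → mono k j ≡ 0ℤ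
mono-off {k} {j} j≢k with j ≟ k
... | yes j≡k = contradiction j≡k j≢k
... | no _    = refl

∑-mono-≥ : ∀ {k n} (X : ℕ → ℤ) → n ≤ k → ∑ (upTo n) (λ j → mono k j ⋆ X j) ≡ 0ℤ
∑-mono-≥ {k} {zero}  X _   = refl
∑-mono-≥ {k} {suc n} X n<k
  rewrite ∑-upTo-suc n (λ j → mono k j ⋆ X j)
        | ∑-mono-≥ X (ℕ.<⇒≤ n<k)
        | mono-off (ℕ.<⇒≢ n<k) = refl

∑-mono-< : ∀ {k n} (X : ℕ → ℤ) → k < n → ∑ (upTo n) (λ j → mono k j ⋆ X j) ≡ X k
∑-mono-< {k} {suc n} X k<1+n
  rewrite ∑-upTo-suc n (λ j → mono k j ⋆ X j) with k ≟ n
... | yes refl rewrite ∑-mono-≥ X (ℕ.≤-refl {k}) | mono-diag k =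
  trans (ℤ.+-identityˡ _) (ℤ.*-identityˡ (X k))
... | no k≢n rewrite ∑-mono-< X (ℕ.≤∧≢⇒< (ℕ.≤-pred k<1+n) k≢n) | mono-off (k≢n ∘ sym) =
  ℤ.+-identityʳ (X k)

mono-⊛ : ∀ k h m → (mono k ⊛ h) m ≡ shift k h m
mono-⊛ k h m with k ≤? m
... | yes k≤m = trans (∑-mono-< (λ j → h (m ∸ j)) (s≤s k≤m)) (sym (shift-≤ h k≤m))
... | no k≰m  = trans (∑-mono-≥ (λ j → h (m ∸ j)) (ℕ.≰⇒> k≰m)) (sym (shift-≰ h k≰m))

⊛-distribʳ-⊕ : ∀ f g h m → ((f ⊕ g) ⊛ h) m ≡ (f ⊛ h) m ⊹ (g ⊛ h) m
⊛-distribʳ-⊕ f g h m =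
  trans (∑-cong (upTo (suc m)) (λ j → ℤ.*-distribʳ-+ (h (m ∸ j)) (f j) (g j)))
        (∑-+ (upTo (suc m)) (λ j → f j ⋆ h (m ∸ j)) (λ j → g j ⋆ h (m ∸ j)))

⊛-distribʳ-⊖ : ∀ f g h m → ((f ⊖ g) ⊛ h) m ≡ (f ⊛ h) m ⊟ (g ⊛ h) m
⊛-distribʳ-⊖ f g h m = begin
  ((f ⊖ g) ⊛ h) m
    ≡⟨ ∑-cong (upTo (suc m)) distrib ⟩
  ∑ (upTo (suc m)) (λ j → f j ⋆ h (m ∸ j) ⊹ - (g j ⋆ h (m ∸ j)))
    ≡⟨ ∑-+ (upTo (suc m)) (λ j → f j ⋆ h (m ∸ j)) (λ j → - (g j ⋆ h (m ∸ j))) ⟩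
  (f ⊛ h) m ⊹ ∑ (upTo (suc m)) (λ j → - (g j ⋆ h (m ∸ j)))
    ≡⟨ cong ((f ⊛ h) m ⊹_) (∑-neg (upTo (suc m)) (λ j → g j ⋆ h (m ∸ j))) ⟩
  (f ⊛ h) m ⊟ (g ⊛ h) m ∎
  where
  open ≡-Reasoning
  distrib : ∀ j → (f j ⊟ g j) ⋆ h (m ∸ j) ≡ f j ⋆ h (m ∸ j) ⊹ - (g j ⋆ h (m ∸ j))
  distrib j = trans (ℤ.*-distribʳ-+ (h (m ∸ j)) (f j) (- g j))
                    (cong (f j ⋆ h (m ∸ j) ⊹_) (sym (ℤ.neg-distribˡ-* (g j) (h (m ∸ j)))))

scale-⊛ : ∀ z f h m → (scale z f ⊛ h) m ≡ z ⋆ (f ⊛ h) m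
scale-⊛ z f h m =
  trans (∑-cong (upTo (suc m)) (λ j → ℤ.*-assoc z (f j) (h (m ∸ j))))
        (∑-scale (upTo (suc m)) z (λ j → f j ⋆ h (m ∸ j)))

denom-⊛ : ∀ a b c F m → (denom a b c ⊛ F) m ≡
  F m ⊟ shift a F m ⊟ shift b F m ⊟ shift c F m ⊹ shift (a + c) F m ⊹ + 2 ⋆ shift (a + 2 * b + c) F m
denom-⊛ a b c F m =
  trans (⊛-distribʳ-⊕ D₄ (scale (+ 2) (mono (a + 2 * b + c))) F m) (cong₂ _⊹_
    (trans (⊛-distribʳ-⊕ D₃ (mono (a + c)) F m) (cong₂ _⊹_
      (trans (⊛-distribʳ-⊖ D₂ (mono c) F m) (cong₂ _⊟_
        (trans (⊛-distribʳ-⊖ D₁ (mono b) F m) (cong₂ _⊟_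
          (trans (⊛-distribʳ-⊖ one (mono a) F m) (cong₂ _⊟_ (mono-⊛ 0 F m) (mono-⊛ a F m)))
          (mono-⊛ b F m)))
        (mono-⊛ c F m)))
      (mono-⊛ (a + c) F m)))
    (trans (scale-⊛ (+ 2) (mono (a + 2 * b + c)) F m) (cong (+ 2 ⋆_) (mono-⊛ (a + 2 * b + c) F m))))
  where
  D₁ D₂ D₃ D₄ : Series
  D₁ = one ⊖ mono a
  D₂ = D₁ ⊖ mono b
  D₃ = D₂ ⊖ mono c
  D₄ = D₃ ⊕ mono (a + c)

emptyCount : List Word → ℕ
emptyCount []             = 0
emptyCount ([]      ∷ Ws) = suc (emptyCount Ws)
emptyCount ((_ ∷ _) ∷ Ws) = emptyCount Ws

∂ : Letter → List Word → List Word
∂ x []             = []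
∂ x ([]      ∷ Ws) = ∂ x Ws
∂ x ((y ∷ w) ∷ Ws) with x ≟ᴸ y
... | yes _ = w ∷ ∂ x Ws
... | no _  = ∂ x Ws

length-∂ : ∀ Ws → length Ws ≡ emptyCount Ws + length (∂ A Ws) + length (∂ B Ws) + length (∂ C Ws)
length-∂ []             = refl
length-∂ ([]      ∷ Ws) = cong suc (length-∂ Ws)
length-∂ ((A ∷ _) ∷ Ws) =
  trans (cong suc (length-∂ Ws)) (cong (λ t → t + length (∂ B Ws) + length (∂ C Ws)) (sym (ℕ.+-suc _ _)))
length-∂ ((B ∷ _) ∷ Ws) =
  trans (cong suc (length-∂ Ws)) (cong (λ t → t + length (∂ C Ws)) (sym (ℕ.+-suc _ _)))
length-∂ ((C ∷ _) ∷ Ws) = trans (cong suc (length-∂ Ws)) (sym (ℕ.+-suc _ _))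

∂-All : ∀ {P : Word → Set} x {Ws} → All P Ws → All (P ∘ (x ∷_)) (∂ x Ws)
∂-All x {[]}             []       = []
∂-All x {[]      ∷ Ws}   (_ ∷ ps) = ∂-All x ps
∂-All x {(y ∷ w) ∷ Ws}   (p ∷ ps) with x ≟ᴸ y
... | yes refl = p ∷ ∂-All x ps
... | no _     = ∂-All x ps

∂-Unique : ∀ x {Ws} → Unique Ws → Unique (∂ x Ws)
∂-Unique x {[]}           []       = []
∂-Unique x {[]      ∷ Ws} (_ ∷ u)  = ∂-Unique x u
∂-Unique x {(y ∷ w) ∷ Ws} (w∉ ∷ u) with x ≟ᴸ y
... | yes refl = All.map (λ w≢v → w≢v ∘ cong (x ∷_)) (∂-All x w∉) ∷ ∂-Unique x u
... | no _     = ∂-Unique x u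

emptyCount-≡0 : ∀ {Ws} → All ([] ≢_) Ws → emptyCount Ws ≡ 0
emptyCount-≡0 {[]}           []          = refl
emptyCount-≡0 {[]      ∷ Ws} ([]≢[] ∷ _) = contradiction refl []≢[]
emptyCount-≡0 {(_ ∷ _) ∷ Ws} (_ ∷ ps)    = emptyCount-≡0 ps

emptyCount-≤1 : ∀ {Ws} → Unique Ws → emptyCount Ws ≤ 1
emptyCount-≤1 {[]}           []        = z≤n
emptyCount-≤1 {[]      ∷ Ws} ([]∉ ∷ _) rewrite emptyCount-≡0 []∉ = s≤s z≤n
emptyCount-≤1 {(_ ∷ _) ∷ Ws} (_ ∷ u)   = emptyCount-≤1 u

module Counting
  {Q : Set} (δ : Q → Letter → Maybe Q) (wt : Letter → ℕ) (wt-pos : ∀ x → 1 ≤ wt x)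
  (σ : Maybe Q → Series) (σ-sink : ∀ m → 0ℤ ≤ℤ σ nothing m)
  (transfer : ∀ q m → σ (just q) m ≡
    one m ⊹ shift (wt A) (σ (δ q A)) m ⊹ shift (wt B) (σ (δ q B)) m ⊹ shift (wt C) (σ (δ q C)) m)
  where

  emptyCount-≤-one : ∀ {m Ws} → Unique Ws → All (λ w → weight wt w ≡ m) Ws → + emptyCount Ws ≤ℤ one m
  emptyCount-≤-one {zero}  u _  = +≤+ (emptyCount-≤1 u)
  emptyCount-≤-one {suc m} _ ws
    rewrite emptyCount-≡0 (All.map (λ { 0≡1+m refl → ℕ.0≢1+n 0≡1+m }) ws) = +≤+ z≤n

  CountBoundAt : ℕ → Set
  CountBoundAt m = ∀ q {Ws} → Unique Ws → All (Accepts δ q) Ws → All (λ w → weight wt w ≡ m) Ws →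
                   + length Ws ≤ℤ σ q m

  count-bound : ∀ m → CountBoundAt m
  count-bound = <-rec CountBoundAt bound-step
    where
    bound-step : ∀ m → (∀ {m′} → m′ < m → CountBoundAt m′) → CountBoundAt m
    bound-step m ih nothing  {[]}    _ _        _  = σ-sink m
    bound-step m ih nothing  {_ ∷ _} _ (() ∷ _) _
    bound-step m ih (just q) {Ws}    u accepted ws =
      subst₂ _≤ℤ_ (cong +_ (sym (length-∂ Ws))) (sym (transfer q m))
        (ℤ.+-mono-≤ (ℤ.+-mono-≤ (ℤ.+-mono-≤ (emptyCount-≤-one u ws) (letter A)) (letter B)) (letter C))
      where
      shifted : ∀ {k q′ Vs} → 1 ≤ k → Unique Vs → All (Accepts δ q′) Vs →
                All (λ v → k + weight wt v ≡ m) Vs →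
                + length Vs ≤ℤ shift k (σ q′) m
      shifted {k} {q′} {Vs} 1≤k u′ accepted′ ws′ with k ≤? m
      ... | yes k≤m = subst (+ length Vs ≤ℤ_) (sym (shift-≤ (σ q′) k≤m))
                        (ih (ℕ.∸-monoʳ-< 1≤k k≤m) q′ u′ accepted′ (All.map (λ {v} → drop-k {v}) ws′))
        where
        drop-k : ∀ {v} → k + weight wt v ≡ m → weight wt v ≡ m ∸ k
        drop-k {v} refl = sym (ℕ.m+n∸m≡n k (weight wt v))
      ... | no k≰m = subst (+ length Vs ≤ℤ_) (sym (shift-≰ (σ q′) k≰m)) (empty ws′)
        where
        empty : ∀ {Vs} → All (λ v → k + weight wt v ≡ m) Vs → + length Vs ≤ℤ 0ℤ
        empty []      = +≤+ z≤n
        empty (e ∷ _) = contradiction (subst (k ≤_) e (ℕ.m≤m+n k _)) k≰m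

      letter : ∀ x → + length (∂ x Ws) ≤ℤ shift (wt x) (σ (δ q x)) m
      letter x = shifted (wt-pos x) (∂-Unique x u) (∂-All x accepted) (∂-All x ws)

module Weights (a b c : ℕ) where

  cost : Letter → ℕ
  cost A = a
  cost B = b
  cost C = c

  -- An item in the input queue still has to make the moves A, B and C, an
  -- item on stack 1 the moves B and C, an item on stack 2 the move C.
  potential : Config → ℕ
  potential (cfg i s t _) = length i * (a + b + c) + length s * (b + c) + length t * c

  step-potential : ∀ x {κ κ′} → step x κ ≡ just κ′ → cost x + potential κ′ ≡ potential κ
  step-potential A {cfg (_ ∷ i) s t _} refl = shuffle a b c (length i) (length s) (length t)
    where
    shuffle : ∀ a b c i s t →
      a + (i * (a + b + c) + suc s * (b + c) + t * c) ≡
      suc i * (a + b + c) + s * (b + c) + t * c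
    shuffle = ℕ-Ring.solve-∀
  step-potential B {cfg i (_ ∷ s) t _} refl = shuffle a b c (length i) (length s) (length t)
    where
    shuffle : ∀ a b c i s t →
      b + (i * (a + b + c) + s * (b + c) + suc t * c) ≡
      i * (a + b + c) + suc s * (b + c) + t * c
    shuffle = ℕ-Ring.solve-∀
  step-potential C {cfg i s (_ ∷ t) _} refl = shuffle a b c (length i) (length s) (length t)
    where
    shuffle : ∀ a b c i s t →
      c + (i * (a + b + c) + s * (b + c) + t * c) ≡
      i * (a + b + c) + s * (b + c) + suc t * c
    shuffle = ℕ-Ring.solve-∀

  run-potential : ∀ w {κ κ′} → run w κ ≡ just κ′ → weight cost w + potential κ′ ≡ potential κ
  run-potential []      refl = refl
  run-potential (x ∷ w) {κ} run≡ with step x κ in step≡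
  ... | just κ₁ = trans (ℕ.+-assoc (cost x) _ _)
                        (trans (cong (_+_ (cost x)) (run-potential w run≡)) (step-potential x step≡))

≡-by-difference : ∀ {x y u v : ℤ} → x ⊟ y ≡ u ⊟ v → u ≡ v → x ≡ y
≡-by-difference {x} {y} {u} x-y≡u-v refl = ℤ.i-j≡0⇒i≡j x y (trans x-y≡u-v (ℤ.+-inverseʳ u))

module Transfer (a b c : ℕ) (F : Series) (F-inv : IsInverseOf F (denom a b c)) where

  open Weights a b c

  -- σ (just q) is F times the numerator of the generating function of
  -- the words accepted from q, counted by weight.
  σ : Maybe State → Series
  σ nothing     = const 0ℤ
  σ (just q₀)   = F
  σ (just qA)   = (F ⊖ shift c F) ⊖ scale (+ 2) (shift (b + (b + c)) F)
  σ (just qAB)  = F ⊖ scale (+ 2) (shift (b + c) F)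
  σ (just qABB) = F ⊖ shift c F
  σ (just qABC) = F ⊖ shift b F

  shifted-σqA : ∀ m →
    shift a (σ (just qA)) m ≡ shift a F m ⊟ shift (a + c) F m ⊟ + 2 ⋆ shift (a + 2 * b + c) F m
  shifted-σqA m = begin
    shift a (σ (just qA)) m
      ≡⟨ shift-⊖ a (F ⊖ shift c F) _ m ⟩
    shift a (F ⊖ shift c F) m ⊟ shift a (scale (+ 2) (shift (b + (b + c)) F)) m
      ≡⟨ cong₂ _⊟_ (shift-⊖ a F (shift c F) m) (shift-scale a (+ 2) _ m) ⟩
    shift a F m ⊟ shift a (shift c F) m ⊟ + 2 ⋆ shift a (shift (b + (b + c)) F) m
      ≡⟨ cong₂ (λ s t → shift a F m ⊟ s ⊟ + 2 ⋆ t)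
               (shift-shift a c F m) (shift-shift a (b + (b + c)) F m) ⟩
    shift a F m ⊟ shift (a + c) F m ⊟ + 2 ⋆ shift (a + (b + (b + c))) F m
      ≡⟨ cong (λ k → shift a F m ⊟ shift (a + c) F m ⊟ + 2 ⋆ shift k F m) (index a b c) ⟩
    shift a F m ⊟ shift (a + c) F m ⊟ + 2 ⋆ shift (a + 2 * b + c) F m ∎
    where
    open ≡-Reasoning
    index : ∀ a b c → a + (b + (b + c)) ≡ a + 2 * b + c
    index = ℕ-Ring.solve-∀

  shifted-σqAB : ∀ m → shift b (σ (just qAB)) m ≡ shift b F m ⊟ + 2 ⋆ shift (b + (b + c)) F m
  shifted-σqAB m = trans (shift-⊖ b F _ m)
    (cong (shift b F m ⊟_) (trans (shift-scale b (+ 2) _ m) (cong (+ 2 ⋆_) (shift-shift b (b + c) F m))))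

  shifted-σqABB : ∀ m → shift b (σ (just qABB)) m ≡ shift b F m ⊟ shift (b + c) F m
  shifted-σqABB m = trans (shift-⊖ b F _ m) (cong (shift b F m ⊟_) (shift-shift b c F m))

  shifted-σqABC : ∀ m → shift c (σ (just qABC)) m ≡ shift c F m ⊟ shift (b + c) F m
  shifted-σqABC m = trans (shift-⊖ c F _ m)
    (cong (shift c F m ⊟_) (trans (shift-shift c b F m) (cong (λ k → shift k F m) (ℕ.+-comm c b))))

  transfer : ∀ q m → σ (just q) m ≡
    one m ⊹ shift a (σ (δ q A)) m ⊹ shift b (σ (δ q B)) m ⊹ shift c (σ (δ q C)) m
  transfer q₀ m rewrite shifted-σqA m =
    ≡-by-difference (algebra (F m) (one m) (shift a F m) (shift b F m) (shift c F m) _ _)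
      (trans (sym (denom-⊛ a b c F m)) (F-inv m))
    where
    algebra : ∀ f o sa sb sc sac sx →
      f ⊟ (o ⊹ (sa ⊟ sac ⊟ + 2 ⋆ sx) ⊹ sb ⊹ sc) ≡ (f ⊟ sa ⊟ sb ⊟ sc ⊹ sac ⊹ + 2 ⋆ sx) ⊟ o
    algebra = ℤ-Ring.solve-∀
  transfer qA m rewrite shifted-σqAB m | shift-0 c m =
    ≡-by-difference (algebra (F m) (one m) (shift a (σ (just qA)) m) (shift b F m) (shift c F m) _) (transfer q₀ m)
    where
    algebra : ∀ f o h sb sc sx →
      f ⊟ sc ⊟ + 2 ⋆ sx ⊟ (o ⊹ h ⊹ (sb ⊟ + 2 ⋆ sx) ⊹ 0ℤ) ≡ f ⊟ (o ⊹ h ⊹ sb ⊹ sc)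
    algebra = ℤ-Ring.solve-∀
  transfer qAB m rewrite shifted-σqABB m | shifted-σqABC m =
    ≡-by-difference (algebra (F m) (one m) (shift a (σ (just qA)) m) (shift b F m) (shift c F m) _) (transfer q₀ m)
    where
    algebra : ∀ f o h sb sc sx →
      f ⊟ + 2 ⋆ sx ⊟ (o ⊹ h ⊹ (sb ⊟ sx) ⊹ (sc ⊟ sx)) ≡ f ⊟ (o ⊹ h ⊹ sb ⊹ sc)
    algebra = ℤ-Ring.solve-∀
  transfer qABB m rewrite shift-0 c m =
    ≡-by-difference (algebra (F m) (one m) (shift a (σ (just qA)) m) (shift b F m) (shift c F m)) (transfer q₀ m)
    where
    algebra : ∀ f o h sb sc → f ⊟ sc ⊟ (o ⊹ h ⊹ sb ⊹ 0ℤ) ≡ f ⊟ (o ⊹ h ⊹ sb ⊹ sc)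
    algebra = ℤ-Ring.solve-∀
  transfer qABC m rewrite shift-0 b m =
    ≡-by-difference (algebra (F m) (one m) (shift a (σ (just qA)) m) (shift b F m) (shift c F m)) (transfer q₀ m)
    where
    algebra : ∀ f o h sb sc → f ⊟ sb ⊟ (o ⊹ h ⊹ 0ℤ ⊹ sc) ≡ f ⊟ (o ⊹ h ⊹ sb ⊹ sc)
    algebra = ℤ-Ring.solve-∀

choose : ∀ {X Y : Set} {R : X → Y → Set} {xs} → All (λ x → ∃ (R x)) xs → ∃ (Pointwise R xs)
choose []             = [] , []
choose ((y , r) ∷ rs) = Prod.map (y ∷_) (r ∷_) (choose rs)

Pointwise⇒All : ∀ {X Y : Set} {R : X → Y → Set} {P : Y → Set} {xs ys} →
                (∀ {x y} → R x y → P y) → Pointwise R xs ys → All P ys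
Pointwise⇒All f []       = []
Pointwise⇒All f (r ∷ rs) = f r ∷ Pointwise⇒All f rs

Unique-Pointwise : ∀ {X Y : Set} {R : X → Y → Set} {xs ys} →
                   (∀ {x x′ y} → R x y → R x′ y → x ≡ x′) → Pointwise R xs ys → Unique xs → Unique ys
Unique-Pointwise           R-injective []       []       = []
Unique-Pointwise {R = R} R-injective (r ∷ rs) (x∉ ∷ u) =
  distinct r rs x∉ ∷ Unique-Pointwise R-injective rs u
  where
  distinct : ∀ {x y xs ys} → R x y → Pointwise R xs ys → All (x ≢_) xs → All (y ≢_) ys
  distinct r []         []         = []
  distinct r (r′ ∷ rs′) (x≢ ∷ x≢s) = (λ { refl → x≢ (R-injective r r′) }) ∷ distinct r rs′ x≢s

initial : ℕ → Config
initial n = cfg (inputQueue n) [] [] []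

final : List ℕ → Config
final π = cfg [] [] [] π

record Encodes (n : ℕ) (π : List ℕ) (w : Word) : Set where
  constructor encodes
  field
    accepted : Accepts δ (just q₀) w
    produces : run w (initial n) ≡ just (final π)

encode : ∀ {n π} → GeneratedBy2Stacks n π → ∃ (Encodes n π)
encode moves with word-of-moves moves
... | w , run≡ with normalise w
... | v , accepted , w≗v = v , encodes accepted (trans (sym (w≗v _)) run≡)

Encodes-injective : ∀ {n π π′ w} → Encodes n π w → Encodes n π′ w → π ≡ π′
Encodes-injective (encodes _ run≡) (encodes _ run≡′) =
  cong Config.output (just-injective (trans (sym run≡) run≡′))

Encodes-weight : ∀ a b c {n π w} → Encodes n π w → weight (Weights.cost a b c) w ≡ n * (a + b + c)
Encodes-weight a b c {n} {_} {w} (encodes _ run≡) = begin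
  weight cost w                          ≡⟨ ℕ.+-identityʳ _ ⟨
  weight cost w + 0                      ≡⟨ run-potential w run≡ ⟩
  length (inputQueue n) * (a + b + c) + 0 + 0
    ≡⟨ trans (ℕ.+-identityʳ _) (ℕ.+-identityʳ _) ⟩
  length (inputQueue n) * (a + b + c)
    ≡⟨ cong (_* (a + b + c)) (trans (List.length-map suc (upTo n)) (List.length-upTo n)) ⟩
  n * (a + b + c)                        ∎
  where
  open ≡-Reasoning
  open Weights a b c

proposition5 : (a₁ a₂ a₃ : ℕ) → 1 ≤ a₁ → 1 ≤ a₂ → 1 ≤ a₃ →
    (F : Series) → IsInverseOf F (denom a₁ a₂ a₃) →
    (n : ℕ) (L : List (List ℕ)) → Unique L → All (GeneratedBy2Stacks n) L →
    + length L ≤ℤ F (n * (a₁ + a₂ + a₃))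
proposition5 a b c 1≤a 1≤b 1≤c F F-inv n L L-unique generated with choose (All.map encode generated)
... | Ws , L≈Ws =
  subst (λ k → + k ≤ℤ F (n * (a + b + c))) (sym (Pointwise-length L≈Ws))
    (count-bound (n * (a + b + c)) (just q₀)
      (Unique-Pointwise Encodes-injective L≈Ws L-unique)
      (Pointwise⇒All Encodes.accepted L≈Ws)
      (Pointwise⇒All (Encodes-weight a b c) L≈Ws))
  where
  open Weights a b c
  open Transfer a b c F F-inv
  cost-pos : ∀ x → 1 ≤ cost x
  cost-pos A = 1≤a
  cost-pos B = 1≤b
  cost-pos C = 1≤c
  open Counting δ cost cost-pos σ (λ _ → ℤ.≤-refl) transfer
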